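{- Let $(L,\vee,\wedge,0,1)$ be a complemented lattice and $a\in L$. Then the following are equivalent: (i) for all $x\in L$, $a\to x=\{1\}$ holds if and only if $a\le x$; (ii) $a$ is a minimal element of $a^{++}$.
   Context: A bounded lattice is complemented if every element $a$ has some $b$ with $a\vee b=1$, $a\wedge b=0$ (complements need not be unique); lattices are non-trivial. For $A\subseteq L$, $A^+:=\{x\in L\mid a\vee x=1\text{ and }a\wedge x=0\text{ for all }a\in A\}$; $a^+:=\{a\}^+$, $a^{++}:=(a^+)^+$. Define $a\to x:=a^+\vee(a\wedge x)=\{y\vee(a\wedge x)\mid y\in a^+\}$. -}

module Defs where

open import Level using (Level; _⊔_)
open import Data.Product using (Σ; _×_; ∃)
open import Relation.Nullary using (¬_)
open import Relation.Binary.Lattice.Bundles using (BoundedLattice)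

module _ {c ℓ₁ ℓ₂ : Level} (L : BoundedLattice c ℓ₁ ℓ₂) where
  open BoundedLattice L

  IsComplement : Carrier → Carrier → Set ℓ₁
  IsComplement a b = (a ∨ b ≈ ⊤) × (a ∧ b ≈ ⊥)

  -- complemented (complements need not be unique)
  Complemented : Set (c ⊔ ℓ₁)
  Complemented = ∀ a → ∃ λ b → IsComplement a b

  NonTrivial : Set ℓ₁
  NonTrivial = ¬ (⊥ ≈ ⊤)

  _⁺ : (Carrier → Set (c ⊔ ℓ₁)) → Carrier → Set (c ⊔ ℓ₁)
  (A ⁺) x = ∀ a → A a → IsComplement a x

  ⟦_⟧ : Carrier → Carrier → Set (c ⊔ ℓ₁)
  ⟦ a ⟧ x = Level.Lift c (x ≈ a)

  _⁺¹ : Carrier → Carrier → Set (c ⊔ ℓ₁)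
  a ⁺¹ = ⟦ a ⟧ ⁺

  _⁺⁺ : Carrier → Carrier → Set (c ⊔ ℓ₁)
  a ⁺⁺ = (a ⁺¹) ⁺

  -- a → x = { y ∨ (a ∧ x) | y ∈ a⁺ }, as a predicate (membership up to ≈)
  _⇒_ : Carrier → Carrier → Carrier → Set (c ⊔ ℓ₁)
  (a ⇒ x) z = ∃ λ y → (a ⁺¹) y × (z ≈ y ∨ (a ∧ x))

  IsTopSingleton : (Carrier → Set (c ⊔ ℓ₁)) → Set (c ⊔ ℓ₁)
  IsTopSingleton S = (∀ z → S z → z ≈ ⊤) × S ⊤

  IsMinimalIn : Carrier → (Carrier → Set (c ⊔ ℓ₁)) → Set (c ⊔ ℓ₁ ⊔ ℓ₂)
  IsMinimalIn a S = S a × (∀ z → S z → z ≤ a → z ≈ a)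

-- The arrow a → x is {1} exactly when a ∧ x lies in a⁺⁺: every y ∈ a⁺ already meets
-- a ∧ x ≤ a in 0, so only the joins y ∨ (a ∧ x) = 1 matter, and a⁺ is non-empty because
-- a has a complement. Moreover a ∈ a⁺⁺, and a ∧ x ≤ a with equality iff a ≤ x. Hence (i)
-- says that the only element of a⁺⁺ of the form a ∧ x is a itself, and since every z ≤ a
-- equals a ∧ z, this is the minimality of a in a⁺⁺.
module Submission where

open import Defs
open import Level using (Level; _⊔_; lift)
open import Data.Product using (_×_; _,_; proj₁; proj₂; ∃)
open import Relation.Binary.Lattice.Bundles using (BoundedLattice)
import Relation.Binary.Lattice.Properties.MeetSemilattice as MeetProperties
import Relation.Binary.Lattice.Properties.JoinSemilattice as JoinProperties

module _ {c ℓ₁ ℓ₂ : Level} (L : BoundedLattice c ℓ₁ ℓ₂) where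
  open BoundedLattice L
  open MeetProperties meetSemilattice using (∧-comm; ∧-cong; ∧-monotonic; y≤x⇒x∧y≈y)
  open JoinProperties joinSemilattice using (∨-comm; ∨-cong)

  private
    variable
      a b x y : Carrier

  IsComplement-sym : IsComplement L a b → IsComplement L b a
  IsComplement-sym {a} {b} (a∨b≈⊤ , a∧b≈⊥) =
    Eq.trans (∨-comm b a) a∨b≈⊤ , Eq.trans (∧-comm b a) a∧b≈⊥

  IsComplement-respˡ : a ≈ b → IsComplement L a y → IsComplement L b y
  IsComplement-respˡ a≈b (a∨y≈⊤ , a∧y≈⊥) =
    Eq.trans (∨-cong (Eq.sym a≈b) Eq.refl) a∨y≈⊤ , Eq.trans (∧-cong (Eq.sym a≈b) Eq.refl) a∧y≈⊥

  IsComplement-respʳ : x ≈ y → IsComplement L a x → IsComplement L a y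
  IsComplement-respʳ x≈y (a∨x≈⊤ , a∧x≈⊥) =
    Eq.trans (∨-cong Eq.refl (Eq.sym x≈y)) a∨x≈⊤ , Eq.trans (∧-cong Eq.refl (Eq.sym x≈y)) a∧x≈⊥

  ⁺-resp-≈ : (A : Carrier → Set (c ⊔ ℓ₁)) → x ≈ y → (_⁺ L A) x → (_⁺ L A) y
  ⁺-resp-≈ A x≈y x∈A⁺ a a∈A = IsComplement-respʳ x≈y (x∈A⁺ a a∈A)

  ⁺¹⇒IsComplement : (_⁺¹ L a) b → IsComplement L a b
  ⁺¹⇒IsComplement b∈a⁺ = b∈a⁺ _ (lift Eq.refl)

  IsComplement⇒⁺¹ : IsComplement L a b → (_⁺¹ L a) b
  IsComplement⇒⁺¹ a⊥b a' (lift a'≈a) = IsComplement-respˡ (Eq.sym a'≈a) a⊥b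

  ∈⁺⁺ : (_⁺⁺ L a) a
  ∈⁺⁺ y y∈a⁺ = IsComplement-sym (⁺¹⇒IsComplement y∈a⁺)

  arrowTop⇒∧∈⁺⁺ : IsTopSingleton L (_⇒_ L a x) → (_⁺⁺ L a) (a ∧ x)
  arrowTop⇒∧∈⁺⁺ {a} {x} (onlyTop , _) y y∈a⁺ = onlyTop (y ∨ (a ∧ x)) (y , y∈a⁺ , Eq.refl) , meet≈⊥
    where
    y∧a≈⊥ : y ∧ a ≈ ⊥
    y∧a≈⊥ = proj₂ (IsComplement-sym (⁺¹⇒IsComplement y∈a⁺))

    meet≈⊥ : y ∧ (a ∧ x) ≈ ⊥
    meet≈⊥ = antisym (trans (∧-monotonic refl (x∧y≤x a x)) (reflexive y∧a≈⊥)) (minimum _)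

  ∧∈⁺⁺⇒arrowTop : ∃ (IsComplement L a) → (_⁺⁺ L a) (a ∧ x) → IsTopSingleton L (_⇒_ L a x)
  ∧∈⁺⁺⇒arrowTop {a} (b , a⊥b) a∧x∈a⁺⁺ =
      (λ { z (y , y∈a⁺ , z≈y∨a∧x) → Eq.trans z≈y∨a∧x (proj₁ (a∧x∈a⁺⁺ y y∈a⁺)) })
    , (b , b∈a⁺ , Eq.sym (proj₁ (a∧x∈a⁺⁺ b b∈a⁺)))
    where
    b∈a⁺ : (_⁺¹ L a) b
    b∈a⁺ = IsComplement⇒⁺¹ a⊥b

  ≤⇒∧≈ : a ≤ x → a ∧ x ≈ a
  ≤⇒∧≈ {a} {x} a≤x = Eq.trans (∧-comm a x) (y≤x⇒x∧y≈y a≤x)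

  ∧≈⇒≤ : a ∧ x ≈ a → a ≤ x
  ∧≈⇒≤ {a} {x} a∧x≈a = trans (reflexive (Eq.sym a∧x≈a)) (x∧y≤y a x)

  ArrowTopIff≤ : Carrier → Set (c ⊔ ℓ₁ ⊔ ℓ₂)
  ArrowTopIff≤ a = ∀ x → (IsTopSingleton L (_⇒_ L a x) → a ≤ x) × (a ≤ x → IsTopSingleton L (_⇒_ L a x))

  arrowTopIff≤⇒minimal : ∃ (IsComplement L a) → ArrowTopIff≤ a → IsMinimalIn L a (_⁺⁺ L a)
  arrowTopIff≤⇒minimal {a} complement criterion = ∈⁺⁺ , minimal
    where
    minimal : ∀ z → (_⁺⁺ L a) z → z ≤ a → z ≈ a
    minimal z z∈a⁺⁺ z≤a = antisym z≤a (proj₁ (criterion z) (∧∈⁺⁺⇒arrowTop complement a∧z∈a⁺⁺))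
      where
      a∧z∈a⁺⁺ : (_⁺⁺ L a) (a ∧ z)
      a∧z∈a⁺⁺ = ⁺-resp-≈ (_⁺¹ L a) (Eq.sym (y≤x⇒x∧y≈y z≤a)) z∈a⁺⁺

  minimal⇒arrowTopIff≤ : ∃ (IsComplement L a) → IsMinimalIn L a (_⁺⁺ L a) → ArrowTopIff≤ a
  minimal⇒arrowTopIff≤ {a} complement (_ , minimal) x =
      (λ top → ∧≈⇒≤ (minimal (a ∧ x) (arrowTop⇒∧∈⁺⁺ top) (x∧y≤x a x)))
    , (λ a≤x → ∧∈⁺⁺⇒arrowTop complement (⁺-resp-≈ (_⁺¹ L a) (Eq.sym (≤⇒∧≈ a≤x)) ∈⁺⁺))

proposition3p4 : {c ℓ₁ ℓ₂ : Level} (L : BoundedLattice c ℓ₁ ℓ₂) →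
    NonTrivial L → Complemented L → (a : BoundedLattice.Carrier L) →
    ((∀ x → (IsTopSingleton L (_⇒_ L a x) → BoundedLattice._≤_ L a x)
              × (BoundedLattice._≤_ L a x → IsTopSingleton L (_⇒_ L a x)))
      → IsMinimalIn L a (_⁺⁺ L a))
    × (IsMinimalIn L a (_⁺⁺ L a)
      → ∀ x → (IsTopSingleton L (_⇒_ L a x) → BoundedLattice._≤_ L a x)
              × (BoundedLattice._≤_ L a x → IsTopSingleton L (_⇒_ L a x)))
proposition3p4 L _ complemented a =
  arrowTopIff≤⇒minimal L (complemented a) , minimal⇒arrowTopIff≤ L (complemented a)
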